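{- For every integer $n>0$, $$\sum_{k=0}^{n}(-1)^k\begin{bmatrix}n\\k\end{bmatrix}_q(-1;q)_{n-k}\,(-1;q)_k=0$$ (as an identity in the variable $q$).
   Context: The $q$-binomial coefficient is $\begin{bmatrix}n\\k\end{bmatrix}_q=\frac{(q^n-1)\cdots(q-1)}{(q^k-1)\cdots(q-1)\,(q^{n-k}-1)\cdots(q-1)}$, and the $q$-Pochhammer symbol is $(a;q)_m=\prod_{i=0}^{m-1}(1-aq^i)$, so $(-1;q)_m=\prod_{i=0}^{m-1}(1+q^i)$. -}

module Defs where

open import Level using (Level)
open import Data.Nat using (ℕ; zero; suc; _∸_)
open import Algebra.Bundles using (CommutativeRing)

-- A polynomial identity in ℤ[q] is equivalent to the identity holding for every
-- element q of every commutative ring (take R = ℤ[q], q = the variable).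
module QDefs {c ℓ : Level} (R : CommutativeRing c ℓ) where
  open CommutativeRing R hiding (zero)

  pow : Carrier → ℕ → Carrier
  pow x zero    = 1#
  pow x (suc m) = x * pow x m

  sign : ℕ → Carrier
  sign zero    = 1#
  sign (suc m) = - sign m

  -- Gaussian (q-binomial) polynomial [n choose k]_q, via the q-Pascal rule
  -- [n+1, k+1] = [n, k] + q^(k+1) [n, k+1]; this is the polynomial equal to
  -- (q^n-1)...(q-1) / ((q^k-1)...(q-1) (q^(n-k)-1)...(q-1)) for k ≤ n, and 0 for k > n.
  qbinom : Carrier → ℕ → ℕ → Carrier
  qbinom q n       zero    = 1#
  qbinom q zero    (suc k) = 0#
  qbinom q (suc n) (suc k) = qbinom q n k + pow q (suc k) * qbinom q n (suc k)

  negOnePoch : Carrier → ℕ → Carrier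
  negOnePoch q zero    = 1#
  negOnePoch q (suc m) = negOnePoch q m * (1# + pow q m)

  sumTo : ℕ → (ℕ → Carrier) → Carrier
  sumTo zero    f = f zero
  sumTo (suc n) f = sumTo n f + f (suc n)

  term : Carrier → ℕ → ℕ → Carrier
  term q n k = sign k * qbinom q n k * negOnePoch q (n ∸ k) * negOnePoch q k

{-# OPTIONS --safe #-}
-- The theorem is the case a = b = -1 of the identity
--   Σ_k [n k]_q (a;q)_k (b;q)_{n-k} b^k = (ab;q)_n,
-- whose right-hand side (1;q)_n vanishes for n > 0 because of its factor 1 - 1.
-- The identity holds by induction on n: the q-Pascal rule splits the sum for n + 1 into
-- (1 - a) b times the sum for (aq, b) and (1 - b) times the sum for (a, bq), both equal to
-- (abq;q)_n, and (1 - a) b + (1 - b) = 1 - ab.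
module Submission where

open import Defs
open import Level using (Level)
open import Data.Nat using (ℕ; zero; suc; _∸_; _<_; _≤_; z≤n; s≤s)
open import Data.Nat.Properties using (≤-refl; m≤n⇒m≤1+n; m<n⇒m<1+n; +-∸-assoc)
open import Relation.Binary.PropositionalEquality as ≡ using (_≡_)
open import Algebra.Bundles using (CommutativeRing)

module QBinomial {c ℓ : Level} (R : CommutativeRing c ℓ) where
  open CommutativeRing R hiding (zero)
  open QDefs R
  open import Algebra.Properties.Ring ring using (-1*x≈-x; -‿involutive; [y-z]x≈yx-zx)
  open import Algebra.Properties.CommutativeSemiring.Exp commutativeSemiring using (_^_; ^-distrib-*)
  open import Algebra.Solver.Ring.NaturalCoefficients.Default commutativeSemiring
    using (solve; _:=_; _:+_; _:*_; con)
  open import Relation.Binary.Reasoning.Setoid setoid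

  sumTo-cong : ∀ n {f g : ℕ → Carrier} → (∀ {k} → k ≤ n → f k ≈ g k) →
               sumTo n f ≈ sumTo n g
  sumTo-cong zero    f≈g = f≈g z≤n
  sumTo-cong (suc n) f≈g = +-cong (sumTo-cong n (λ k≤n → f≈g (m≤n⇒m≤1+n k≤n))) (f≈g ≤-refl)

  sumTo-distrib-+ : ∀ n (f g : ℕ → Carrier) →
                    sumTo n (λ k → f k + g k) ≈ sumTo n f + sumTo n g
  sumTo-distrib-+ zero    f g = refl
  sumTo-distrib-+ (suc n) f g = begin
    sumTo n (λ k → f k + g k) + (f (suc n) + g (suc n))
      ≈⟨ +-congʳ (sumTo-distrib-+ n f g) ⟩
    sumTo n f + sumTo n g + (f (suc n) + g (suc n))
      ≈⟨ solve 4 (λ F G x y → (F :+ G :+ (x :+ y)) := (F :+ x :+ (G :+ y))) refl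
           (sumTo n f) (sumTo n g) (f (suc n)) (g (suc n)) ⟩
    sumTo n f + f (suc n) + (sumTo n g + g (suc n))
      ∎

  *-distribˡ-sumTo : ∀ n x (f : ℕ → Carrier) → x * sumTo n f ≈ sumTo n (λ k → x * f k)
  *-distribˡ-sumTo zero    x f = refl
  *-distribˡ-sumTo (suc n) x f = trans (distribˡ x _ _) (+-congʳ (*-distribˡ-sumTo n x f))

  sumTo-unfoldˡ : ∀ n (f : ℕ → Carrier) → sumTo (suc n) f ≈ f 0 + sumTo n (λ k → f (suc k))
  sumTo-unfoldˡ zero    f = refl
  sumTo-unfoldˡ (suc n) f = trans (+-congʳ (sumTo-unfoldˡ n f)) (+-assoc _ _ _)

  sumTo-pascal : ∀ n (f g h : ℕ → Carrier) →
                 f 0 ≈ h 0 → (∀ k → f (suc k) ≈ g k + h (suc k)) → h (suc n) ≈ 0# →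
                 sumTo (suc n) f ≈ sumTo n g + sumTo n h
  sumTo-pascal n f g h f0≈h0 f≈g+h hn+1≈0 = begin
    sumTo (suc n) f                                ≈⟨ sumTo-unfoldˡ n f ⟩
    f 0 + sumTo n (λ k → f (suc k))                ≈⟨ +-cong f0≈h0 (sumTo-cong n (λ {k} _ → f≈g+h k)) ⟩
    h 0 + sumTo n (λ k → g k + h (suc k))          ≈⟨ +-congˡ (sumTo-distrib-+ n g (λ k → h (suc k))) ⟩
    h 0 + (sumTo n g + sumTo n (λ k → h (suc k)))
      ≈⟨ solve 3 (λ x G H → (x :+ (G :+ H)) := (G :+ (x :+ H))) refl
           (h 0) (sumTo n g) (sumTo n (λ k → h (suc k))) ⟩
    sumTo n g + (h 0 + sumTo n (λ k → h (suc k)))  ≈⟨ +-congˡ (sym (sumTo-unfoldˡ n h)) ⟩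
    sumTo n g + (sumTo n h + h (suc n))            ≈⟨ +-congˡ (trans (+-congˡ hn+1≈0) (+-identityʳ _)) ⟩
    sumTo n g + sumTo n h                          ∎

  pow≡^ : ∀ x n → pow x n ≡ x ^ n
  pow≡^ x zero    = ≡.refl
  pow≡^ x (suc n) = ≡.cong (x *_) (pow≡^ x n)

  pow-distrib-* : ∀ x y n → pow (x * y) n ≈ pow x n * pow y n
  pow-distrib-* x y n rewrite pow≡^ (x * y) n | pow≡^ x n | pow≡^ y n = ^-distrib-* x y n

  sign≈pow[-1] : ∀ k → sign k ≈ pow (- 1#) k
  sign≈pow[-1] zero    = refl
  sign≈pow[-1] (suc k) = trans (-‿cong (sign≈pow[-1] k)) (sym (-1*x≈-x _))

  -1*-1≈1 : - 1# * - 1# ≈ 1#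
  -1*-1≈1 = trans (-1*x≈-x (- 1#)) (-‿involutive 1#)

  [1-a]b+[1-b]≈1-ab : ∀ a b → (1# - a) * b + (1# - b) ≈ 1# - a * b
  [1-a]b+[1-b]≈1-ab a b = begin
    (1# - a) * b + (1# - b)      ≈⟨ +-congʳ ([y-z]x≈yx-zx b 1# a) ⟩
    (1# * b - a * b) + (1# - b)
      ≈⟨ solve 3 (λ b -ab -b → (con 1 :* b :+ -ab :+ (con 1 :+ -b)) := (b :+ -b :+ (con 1 :+ -ab)))
           refl b (- (a * b)) (- b) ⟩
    (b - b) + (1# - a * b)       ≈⟨ +-congʳ (-‿inverseʳ b) ⟩
    0# + (1# - a * b)            ≈⟨ +-identityˡ _ ⟩
    1# - a * b                   ∎

  module _ (q : Carrier) where

    qPoch : Carrier → ℕ → Carrier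
    qPoch a zero    = 1#
    qPoch a (suc m) = qPoch a m * (1# - a * pow q m)

    qPoch-cong : ∀ {a b} m → a ≈ b → qPoch a m ≈ qPoch b m
    qPoch-cong zero    a≈b = refl
    qPoch-cong (suc m) a≈b = *-cong (qPoch-cong m a≈b) (+-congˡ (-‿cong (*-congʳ a≈b)))

    qPoch-unfoldˡ : ∀ a m → qPoch a (suc m) ≈ (1# - a) * qPoch (a * q) m
    qPoch-unfoldˡ a zero    = begin
      1# * (1# - a * 1#)  ≈⟨ *-identityˡ _ ⟩
      1# - a * 1#         ≈⟨ +-congˡ (-‿cong (*-identityʳ a)) ⟩
      1# - a              ≈⟨ *-identityʳ _ ⟨
      (1# - a) * 1#       ∎
    qPoch-unfoldˡ a (suc m) = begin
      qPoch a (suc m) * (1# - a * (q * pow q m))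
        ≈⟨ *-cong (qPoch-unfoldˡ a m) (+-congˡ (-‿cong (sym (*-assoc a q _)))) ⟩
      (1# - a) * qPoch (a * q) m * (1# - a * q * pow q m)
        ≈⟨ *-assoc _ _ _ ⟩
      (1# - a) * qPoch (a * q) (suc m)
        ∎

    qPoch-one≈0 : ∀ m → qPoch 1# (suc m) ≈ 0#
    qPoch-one≈0 m = trans (qPoch-unfoldˡ 1# m) (trans (*-congʳ (-‿inverseʳ 1#)) (zeroˡ _))

    negOnePoch≈qPoch : ∀ m → negOnePoch q m ≈ qPoch (- 1#) m
    negOnePoch≈qPoch zero    = refl
    negOnePoch≈qPoch (suc m) =
      *-cong (negOnePoch≈qPoch m) (+-congˡ (sym (trans (-‿cong (-1*x≈-x _)) (-‿involutive _))))

    n<k⇒qbinom≈0 : ∀ {n k} → n < k → qbinom q n k ≈ 0#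
    n<k⇒qbinom≈0 {zero}  {suc k} _         = refl
    n<k⇒qbinom≈0 {suc n} {suc k} (s≤s n<k) = begin
      qbinom q n k + pow q (suc k) * qbinom q n (suc k)
        ≈⟨ +-cong (n<k⇒qbinom≈0 n<k) (*-congˡ (n<k⇒qbinom≈0 (m<n⇒m<1+n n<k))) ⟩
      0# + pow q (suc k) * 0#
        ≈⟨ trans (+-identityˡ _) (zeroʳ _) ⟩
      0#
        ∎

    qBinomialSum : ℕ → Carrier → Carrier → Carrier
    qBinomialSum n a b = sumTo n (λ k → qbinom q n k * qPoch a k * qPoch b (n ∸ k) * pow b k)

    qBinomialSum-suc : ∀ n a b → qBinomialSum (suc n) a b ≈
                       (1# - a) * b * qBinomialSum n (a * q) b + (1# - b) * qBinomialSum n a (b * q)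
    qBinomialSum-suc n a b = trans (sumTo-pascal n f g h refl f≈g+h hn+1≈0) (+-cong sum-g sum-h)
      where
      f g h : ℕ → Carrier
      f k = qbinom q (suc n) k * qPoch a k * qPoch b (suc n ∸ k) * pow b k
      g k = qbinom q n k * qPoch a (suc k) * qPoch b (n ∸ k) * pow b (suc k)
      h k = qbinom q n k * qPoch a k * qPoch b (suc n ∸ k) * pow (b * q) k

      f≈g+h : ∀ k → f (suc k) ≈ g k + h (suc k)
      f≈g+h k = begin
        (qbinom q n k + pow q (suc k) * qbinom q n (suc k)) * A * B * pow b (suc k)
          ≈⟨ solve 6 (λ c Q d A B P → ((c :+ Q :* d) :* A :* B :* P)
                                      := (c :* A :* B :* P :+ d :* A :* B :* (P :* Q)))
               refl (qbinom q n k) (pow q (suc k)) (qbinom q n (suc k)) A B (pow b (suc k)) ⟩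
        g k + qbinom q n (suc k) * A * B * (pow b (suc k) * pow q (suc k))
          ≈⟨ +-congˡ (*-congˡ (pow-distrib-* b q (suc k))) ⟨
        g k + h (suc k)
          ∎
        where
        A = qPoch a (suc k)
        B = qPoch b (n ∸ k)

      hn+1≈0 : h (suc n) ≈ 0#
      hn+1≈0 = trans (*-congʳ (*-congʳ (*-congʳ (n<k⇒qbinom≈0 {n} ≤-refl))))
                     (solve 3 (λ A B P → (con 0 :* A :* B :* P) := con 0) refl _ _ _)

      sum-g : sumTo n g ≈ (1# - a) * b * qBinomialSum n (a * q) b
      sum-g = trans (sumTo-cong n g≈) (sym (*-distribˡ-sumTo n _ _))
        where
        g≈ : ∀ {k} → k ≤ n →
             g k ≈ (1# - a) * b * (qbinom q n k * qPoch (a * q) k * qPoch b (n ∸ k) * pow b k)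
        g≈ {k} _ = trans (*-congʳ (*-congʳ (*-congˡ (qPoch-unfoldˡ a k))))
          (solve 6 (λ c u A B x P → (c :* (u :* A) :* B :* (x :* P)) := (u :* x :* (c :* A :* B :* P)))
             refl (qbinom q n k) (1# - a) (qPoch (a * q) k) (qPoch b (n ∸ k)) b (pow b k))

      sum-h : sumTo n h ≈ (1# - b) * qBinomialSum n a (b * q)
      sum-h = trans (sumTo-cong n h≈) (sym (*-distribˡ-sumTo n _ _))
        where
        h≈ : ∀ {k} → k ≤ n →
             h k ≈ (1# - b) * (qbinom q n k * qPoch a k * qPoch (b * q) (n ∸ k) * pow (b * q) k)
        h≈ {k} k≤n rewrite +-∸-assoc 1 k≤n = trans (*-congʳ (*-congˡ (qPoch-unfoldˡ b (n ∸ k))))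
          (solve 5 (λ c A u B P → (c :* A :* (u :* B) :* P) := (u :* (c :* A :* B :* P)))
             refl (qbinom q n k) (qPoch a k) (1# - b) (qPoch (b * q) (n ∸ k)) (pow (b * q) k))

    qBinomialSum≈qPoch : ∀ n a b → qBinomialSum n a b ≈ qPoch (a * b) n
    qBinomialSum≈qPoch zero    a b = trans (*-identityʳ _) (trans (*-identityʳ _) (*-identityʳ _))
    qBinomialSum≈qPoch (suc n) a b = begin
      qBinomialSum (suc n) a b
        ≈⟨ qBinomialSum-suc n a b ⟩
      (1# - a) * b * qBinomialSum n (a * q) b + (1# - b) * qBinomialSum n a (b * q)
        ≈⟨ +-cong (*-congˡ (qBinomialSum≈qPoch n (a * q) b))
                  (*-congˡ (qBinomialSum≈qPoch n a (b * q))) ⟩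
      (1# - a) * b * qPoch (a * q * b) n + (1# - b) * qPoch (a * (b * q)) n
        ≈⟨ +-cong (*-congˡ (qPoch-cong n aq·b≈ab·q)) (*-congˡ (qPoch-cong n (sym (*-assoc a b q)))) ⟩
      (1# - a) * b * qPoch (a * b * q) n + (1# - b) * qPoch (a * b * q) n
        ≈⟨ distribʳ _ _ _ ⟨
      ((1# - a) * b + (1# - b)) * qPoch (a * b * q) n
        ≈⟨ *-congʳ ([1-a]b+[1-b]≈1-ab a b) ⟩
      (1# - a * b) * qPoch (a * b * q) n
        ≈⟨ qPoch-unfoldˡ (a * b) n ⟨
      qPoch (a * b) (suc n)
        ∎
      where
      aq·b≈ab·q : a * q * b ≈ a * b * q
      aq·b≈ab·q = solve 3 (λ a q b → (a :* q :* b) := (a :* b :* q)) refl a q b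

    sumTo-term≈qBinomialSum : ∀ n → sumTo n (term q n) ≈ qBinomialSum n (- 1#) (- 1#)
    sumTo-term≈qBinomialSum n = sumTo-cong n (λ {k} _ → term≈ k)
      where
      term≈ : ∀ k → term q n k ≈ qbinom q n k * qPoch (- 1#) k * qPoch (- 1#) (n ∸ k) * pow (- 1#) k
      term≈ k = trans
        (solve 4 (λ s c B A → (s :* c :* B :* A) := (c :* A :* B :* s))
           refl (sign k) (qbinom q n k) (negOnePoch q (n ∸ k)) (negOnePoch q k))
        (*-cong (*-cong (*-congˡ (negOnePoch≈qPoch k)) (negOnePoch≈qPoch (n ∸ k))) (sign≈pow[-1] k))

lemma6p14 : ∀ {c ℓ : Level} (R : CommutativeRing c ℓ) (q : CommutativeRing.Carrier R) (n : ℕ) →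
    0 < n →
    CommutativeRing._≈_ R (QDefs.sumTo R n (λ k → QDefs.term R q n k)) (CommutativeRing.0# R)
lemma6p14 R q (suc m) _ = begin
  sumTo (suc m) (term q (suc m))         ≈⟨ sumTo-term≈qBinomialSum q (suc m) ⟩
  qBinomialSum q (suc m) (- 1#) (- 1#)   ≈⟨ qBinomialSum≈qPoch q (suc m) (- 1#) (- 1#) ⟩
  qPoch q (- 1# * - 1#) (suc m)          ≈⟨ qPoch-cong q (suc m) -1*-1≈1 ⟩
  qPoch q 1# (suc m)                     ≈⟨ qPoch-one≈0 q m ⟩
  0#                                     ∎
  where
  open CommutativeRing R
  open QDefs R
  open QBinomial R
  open import Relation.Binary.Reasoning.Setoid setoid
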